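{- Let $H$ be a connected finite hypergraph without loops in which every hypervertex belongs to at least two hyperedges, $B_H$ its bipartite graph with vertices $x_1,\dots,x_n$ and $m=|E(B_H)|$, $E(R(B_H))=\{e_1,\dots,e_{2m}\}$, $\phi$ a permutation voltage assignment on $B_H$, $\Gamma=\langle\phi(e)\mid e\in E(R(B_H))\rangle$, and $\rho$ a unitary representation of $\Gamma$ of degree $l$. Then $$K\,{}^t\overline{K}=BJ+I_{2ml}.$$
   Context: A hypergraph $H$ is a finite set $V(H)$ with a finite collection $E(H)$ of nonempty subsets (hyperedges) covering $V(H)$; "without loops" means no hyperedge has one element. $B_H$ has vertex set $V(H)\sqcup E(H)$ and edges $\{v,e\}$ for $v\in e$. $R(B_H)$ is the symmetric digraph with directed edges $(x,y),(y,x)$ for each edge $\{x,y\}$; for $e=(x,y)$: $o(e)=x$, $t(e)=y$, $e^{ -1}=(y,x)$. A permutation voltage assignment is $\phi:E(R(B_H))\to\mathcal{S}_k$ with $\phi(e^{ -1})=\phi(e)^{ -1}$. All matrices are block matrices with $l\times l$ blocks. $K=(k_{\alpha\beta})$ is $2m\times n$ with $k_{\alpha\beta}=\rho(\phi(e_\alpha))$ if $t(e_\alpha)=x_\beta$, else $0_l$; ${}^t\overline{K}$ is its conjugate transpose. $B=(b_{\alpha\beta})$, $J=(j_{\alpha\beta})$ are $2m\times2m$: $b_{\alpha\beta}=\rho(\phi(e_\alpha))$ if $t(e_\alpha)=o(e_\beta)$ and $e_\alpha\ne e_\beta^{ -1}$, else $0_l$; $j_{\alpha\beta}=\rho(\phi(e_\alpha))$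 if $e_\alpha=e_\beta^{ -1}$, else $0_l$. -}

module Defs where

open import Level using (Level; _⊔_) renaming (suc to lsuc)
open import Data.Nat using (ℕ; zero; suc; _≤_) renaming (_*_ to _*ℕ_)
open import Data.Bool using (Bool; true; false)
open import Data.Fin using (Fin; zero; suc)
open import Data.Fin.Properties using () renaming (_≟_ to _≟ᶠ_)
open import Data.Fin.Subset using (Subset; _∈_; ∣_∣)
open import Data.Fin.Permutation using (Permutation′; _⟨$⟩ʳ_; _∘ₚ_; flip) renaming (id to idₚ; _≈_ to _≈ₚ_)
open import Data.Vec using (tabulate; lookup)
open import Data.Product using (Σ; _×_; _,_; proj₁; proj₂)
open import Data.Sum using (_⊎_; inj₁; inj₂)
open import Data.Sum.Properties using (≡-dec)
open import Function.Bundles using (_↔_; Inverse)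
open import Relation.Nullary using (yes; no; Dec)
open import Relation.Binary.PropositionalEquality using (_≡_)
open import Algebra.Bundles using (CommutativeRing)

record InvRing (c ℓ : Level) : Set (lsuc (c ⊔ ℓ)) where
  field
    ring : CommutativeRing c ℓ
  open CommutativeRing ring
  field
    conj        : Carrier → Carrier
    conj-cong   : ∀ {x y} → x ≈ y → conj x ≈ conj y
    conj-+      : ∀ x y → conj (x + y) ≈ conj x + conj y
    conj-*      : ∀ x y → conj (x * y) ≈ conj x * conj y
    conj-1      : conj 1# ≈ 1#
    conj-invol  : ∀ x → conj (conj x) ≈ x

module Mat {c ℓ} (R : InvRing c ℓ) where
  open InvRing R
  open CommutativeRing ring using (Carrier; _≈_; _+_; _*_; 0#; 1#)

  sumF : ∀ {n} → (Fin n → Carrier) → Carrier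
  sumF {zero}  f = 0#
  sumF {suc n} f = f zero + sumF (λ i → f (suc i))

  infix  4 _≈M_ _≈B_
  infixl 6 _⊕_ _⊕B_
  infixl 7 _⊗_ _⊗B_
  infix  8 _† _†B

  Mat : ℕ → Set c
  Mat l = Fin l → Fin l → Carrier

  _≈M_ : ∀ {l} → Mat l → Mat l → Set ℓ
  A ≈M B = ∀ i j → A i j ≈ B i j

  _⊗_ : ∀ {l} → Mat l → Mat l → Mat l
  (A ⊗ B) i j = sumF (λ k → A i k * B k j)

  _⊕_ : ∀ {l} → Mat l → Mat l → Mat l
  (A ⊕ B) i j = A i j + B i j

  0M : ∀ {l} → Mat l
  0M i j = 0#

  IM : ∀ {l} → Mat l
  IM i j with i ≟ᶠ j
  ... | yes _ = 1#
  ... | no  _ = 0#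

  _† : ∀ {l} → Mat l → Mat l
  (A †) i j = conj (A j i)

  sumM : ∀ {l n} → (Fin n → Mat l) → Mat l
  sumM {l} {zero}  f = 0M
  sumM {l} {suc n} f = f zero ⊕ sumM (λ i → f (suc i))

  Block : ℕ → ℕ → ℕ → Set c
  Block l p q = Fin p → Fin q → Mat l

  _≈B_ : ∀ {l p q} → Block l p q → Block l p q → Set ℓ
  X ≈B Y = ∀ α β → X α β ≈M Y α β

  _⊗B_ : ∀ {l p q r} → Block l p q → Block l q r → Block l p r
  (X ⊗B Y) α γ = sumM (λ β → X α β ⊗ Y β γ)

  _⊕B_ : ∀ {l p q} → Block l p q → Block l p q → Block l p q
  (X ⊕B Y) α β = X α β ⊕ Y α β

  _†B : ∀ {l p q} → Block l p q → Block l q p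
  (X †B) β α = (X α β) †

  IB : ∀ {l p} → Block l p p
  IB α β with α ≟ᶠ β
  ... | yes _ = IM
  ... | no  _ = 0M

record Hypergraph : Set where
  field
    nV    : ℕ
    nE    : ℕ
    edge  : Fin nE → Subset nV

module _ (H : Hypergraph) where
  open Hypergraph H

  NoLoops : Set
  NoLoops = ∀ e → 2 ≤ ∣ edge e ∣

  degree : Fin nV → ℕ
  degree v = ∣ tabulate (λ e → lookup (edge e) v) ∣

  EveryVertexInTwoEdges : Set
  EveryVertexInTwoEdges = ∀ v → 2 ≤ degree v

  -- vertices of B_H : V(H) ⊔ E(H)
  BVertex : Set
  BVertex = Fin nV ⊎ Fin nE

  -- directed edges of R(B_H): an incidence v ∈ e together with a
  -- direction (true : v → e, false : e → v)
  Arc : Set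
  Arc = Σ (Fin nV × Fin nE × Bool) (λ x → proj₁ x ∈ edge (proj₁ (proj₂ x)))

  o : Arc → BVertex
  o ((v , e , true)  , _) = inj₁ v
  o ((v , e , false) , _) = inj₂ e

  t : Arc → BVertex
  t ((v , e , true)  , _) = inj₂ e
  t ((v , e , false) , _) = inj₁ v

  inv : Arc → Arc
  inv ((v , e , true)  , p) = (v , e , false) , p
  inv ((v , e , false) , p) = (v , e , true)  , p

  data Reach : BVertex → BVertex → Set where
    here : ∀ {x} → Reach x x
    step : ∀ {y} (a : Arc) → Reach (t a) y → Reach (o a) y

  -- H is connected : B_H is connected
  Connected : Set
  Connected = ∀ x y → Reach x y

  record Voltage (k : ℕ) : Set where
    field
      φ     : Arc → Permutation′ k
      φ-inv : ∀ a → φ (inv a) ≈ₚ flip (φ a)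

  data InΓ {k : ℕ} (V : Voltage k) : Permutation′ k → Set where
    gen  : ∀ a → InΓ V (Voltage.φ V a)
    one  : InΓ V idₚ
    mul  : ∀ {σ τ} → InΓ V σ → InΓ V τ → InΓ V (σ ∘ₚ τ)
    inv' : ∀ {σ} → InΓ V σ → InΓ V (flip σ)

  record UnitaryRep {c ℓ} (R : InvRing c ℓ) {k : ℕ} (V : Voltage k) (l : ℕ)
         : Set (c ⊔ ℓ) where
    open Mat R
    field
      ρ        : (σ : Permutation′ k) → InΓ V σ → Mat l
      ρ-cong   : ∀ {σ τ} (p : InΓ V σ) (q : InΓ V τ) → σ ≈ₚ τ → ρ σ p ≈M ρ τ q
      ρ-hom    : ∀ {σ τ} (p : InΓ V σ) (q : InΓ V τ) →
                 ρ (σ ∘ₚ τ) (mul p q) ≈M (ρ σ p ⊗ ρ τ q)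
      unitaryʳ : ∀ {σ} (p : InΓ V σ) → (ρ σ p ⊗ (ρ σ p) †) ≈M IM
      unitaryˡ : ∀ {σ} (p : InΓ V σ) → ((ρ σ p) † ⊗ ρ σ p) ≈M IM

  module Matrices {c ℓ} (R : InvRing c ℓ) {n m : ℕ}
                  (xs : Fin n ↔ BVertex) (es : Fin (2 *ℕ m) ↔ Arc)
                  {k : ℕ} (V : Voltage k) {l : ℕ} (U : UnitaryRep R V l) where
    open Mat R
    open UnitaryRep U

    x : Fin n → BVertex
    x = Inverse.to xs

    ε : Fin (2 *ℕ m) → Arc
    ε = Inverse.to es

    ρφ : Fin (2 *ℕ m) → Mat l
    ρφ α = ρ (Voltage.φ V (ε α)) (gen (ε α))

    _≟ᵛ_ : (u w : BVertex) → Dec (u ≡ w)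
    _≟ᵛ_ = ≡-dec _≟ᶠ_ _≟ᶠ_

    invIx : Fin (2 *ℕ m) → Fin (2 *ℕ m)
    invIx β = Inverse.from es (inv (ε β))

    K : Block l (2 *ℕ m) n
    K α β with t (ε α) ≟ᵛ x β
    ... | yes _ = ρφ α
    ... | no  _ = 0M

    B : Block l (2 *ℕ m) (2 *ℕ m)
    B α β with t (ε α) ≟ᵛ o (ε β) | α ≟ᶠ invIx β
    ... | yes _ | no _ = ρφ α
    ... | _     | _    = 0M

    J : Block l (2 *ℕ m) (2 *ℕ m)
    J α β with α ≟ᶠ invIx β
    ... | yes _ = ρφ α
    ... | no  _ = 0M

-- The (α, β) block of K ᵗK̄ is Σ_γ K_αγ ᵗK̄_βγ, and only γ = t(e_α) contributes, so it is
-- ρφ(e_α) ᵗρφ(e_β)‾ when t(e_α) = t(e_β) and 0 otherwise.  Column β of J has the single nonzero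
-- block ρφ(e_β⁻¹) = ᵗρφ(e_β)‾ (unitarity), so (BJ)_αβ = B_{α,β⁻¹} ᵗρφ(e_β)‾, and B_{α,β⁻¹} = ρφ(e_α)
-- exactly when t(e_α) = o(e_β⁻¹) = t(e_β) and α ≠ β.  The two sides therefore differ only on the
-- diagonal, by ρφ(e_α) ᵗρφ(e_α)‾ = I, which is the summand I_{2ml}.
module Submission where

open import Defs
open import Data.Nat using (ℕ; zero; suc) renaming (_*_ to _*ℕ_)
open import Data.Fin using (Fin; zero; suc; punchIn)
open import Data.Fin.Properties using (punchInᵢ≢i) renaming (_≟_ to _≟ᶠ_)
open import Data.Fin.Permutation using (_⟨$⟩ʳ_; _∘ₚ_; flip; inverseˡ) renaming (id to idₚ)
open import Data.Product using (_,_)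
open import Data.Bool using (true; false)
open import Data.Empty using (⊥-elim)
open import Function.Bundles using (_↔_; Inverse)
open import Relation.Nullary using (yes; no; Dec)
open import Relation.Binary.PropositionalEquality as ≡ using (_≡_; _≢_)
open import Relation.Binary.Bundles using (Setoid)
open import Algebra.Bundles using (CommutativeRing)
import Algebra.Properties.Group as GroupProperties
import Algebra.Properties.Semiring.Sum as SemiringSum
import Relation.Binary.Reasoning.Setoid as SetoidReasoning

module MatrixAlgebra {c ℓ} (R : InvRing c ℓ) where
  open InvRing R
  open CommutativeRing ring hiding (zero)
  open Mat R
  open SemiringSum semiring using (sum; sum-cong-≋; sum-replicate-zero; sum-remove; ∑-comm;
                                   *-distribˡ-sum; *-distribʳ-sum)

  conj-0 : conj 0# ≈ 0#
  conj-0 = GroupProperties.identityʳ-unique +-group (conj 0#) (conj 0#)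
             (sym (trans (conj-cong (sym (+-identityʳ 0#))) (conj-+ 0# 0#)))

  sumF≡sum : ∀ {n} (f : Fin n → Carrier) → sumF f ≡ sum f
  sumF≡sum {zero}  f = ≡.refl
  sumF≡sum {suc n} f = ≡.cong (f zero +_) (sumF≡sum (λ i → f (suc i)))

  module _ where
    open SetoidReasoning setoid

    sumF-cong : ∀ {n} {f g : Fin n → Carrier} → (∀ i → f i ≈ g i) → sumF f ≈ sumF g
    sumF-cong {f = f} {g} f≈g = begin
      sumF f ≡⟨ sumF≡sum f ⟩
      sum f  ≈⟨ sum-cong-≋ f≈g ⟩
      sum g  ≡⟨ sumF≡sum g ⟨
      sumF g ∎

    sumF-zero : ∀ {n} (f : Fin n → Carrier) → (∀ i → f i ≈ 0#) → sumF f ≈ 0#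
    sumF-zero {n} f f≈0 = begin
      sumF f              ≈⟨ sumF-cong f≈0 ⟩
      sumF {n} (λ _ → 0#) ≡⟨ sumF≡sum {n} (λ _ → 0#) ⟩
      sum {n} (λ _ → 0#)  ≈⟨ sum-replicate-zero n ⟩
      0#                  ∎

    sumF-single : ∀ {n} (f : Fin n → Carrier) (i : Fin n) →
                  (∀ j → j ≢ i → f j ≈ 0#) → sumF f ≈ f i
    sumF-single {suc n} f i f≈0 = begin
      sumF f                             ≡⟨ sumF≡sum f ⟩
      sum f                              ≈⟨ sum-remove f ⟩
      f i + sum (λ j → f (punchIn i j))  ≡⟨ ≡.cong (f i +_) (sumF≡sum (λ j → f (punchIn i j))) ⟨
      f i + sumF (λ j → f (punchIn i j)) ≈⟨ +-congˡ (sumF-zero _ (λ j → f≈0 _ (punchInᵢ≢i i j))) ⟩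
      f i + 0#                           ≈⟨ +-identityʳ (f i) ⟩
      f i                                ∎

    sumF-comm : ∀ {n p} (f : Fin n → Fin p → Carrier) →
                sumF (λ i → sumF (f i)) ≈ sumF (λ j → sumF (λ i → f i j))
    sumF-comm f = begin
      sumF (λ i → sumF (f i))           ≡⟨ sumF≡sum (λ i → sumF (f i)) ⟩
      sum (λ i → sumF (f i))            ≈⟨ sum-cong-≋ (λ i → reflexive (sumF≡sum (f i))) ⟩
      sum (λ i → sum (f i))             ≈⟨ ∑-comm f ⟩
      sum (λ j → sum (λ i → f i j))     ≈⟨ sum-cong-≋ (λ j → reflexive (≡.sym (sumF≡sum (λ i → f i j)))) ⟩
      sum (λ j → sumF (λ i → f i j))    ≡⟨ sumF≡sum (λ j → sumF (λ i → f i j)) ⟨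
      sumF (λ j → sumF (λ i → f i j))   ∎

    *-distribˡ-sumF : ∀ {n} x (f : Fin n → Carrier) → x * sumF f ≈ sumF (λ i → x * f i)
    *-distribˡ-sumF x f = begin
      x * sumF f             ≡⟨ ≡.cong (x *_) (sumF≡sum f) ⟩
      x * sum f              ≈⟨ *-distribˡ-sum x f ⟩
      sum (λ i → x * f i)    ≡⟨ sumF≡sum (λ i → x * f i) ⟨
      sumF (λ i → x * f i)   ∎

    *-distribʳ-sumF : ∀ {n} x (f : Fin n → Carrier) → sumF f * x ≈ sumF (λ i → f i * x)
    *-distribʳ-sumF x f = begin
      sumF f * x             ≡⟨ ≡.cong (_* x) (sumF≡sum f) ⟩
      sum f * x              ≈⟨ *-distribʳ-sum x f ⟩
      sum (λ i → f i * x)    ≡⟨ sumF≡sum (λ i → f i * x) ⟨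
      sumF (λ i → f i * x)   ∎

  matSetoid : ℕ → Setoid c ℓ
  matSetoid l = record
    { Carrier       = Mat l
    ; _≈_           = _≈M_
    ; isEquivalence = record
      { refl  = λ _ _ → refl
      ; sym   = λ A≈B i j → sym (A≈B i j)
      ; trans = λ A≈B B≈C i j → trans (A≈B i j) (B≈C i j)
      }
    }

  module _ {l : ℕ} where
    open Setoid (matSetoid l) public
      using () renaming (refl to ≈M-refl; trans to ≈M-trans)
    open SetoidReasoning setoid

    ⊗-cong : {A A′ B B′ : Mat l} → A ≈M A′ → B ≈M B′ → A ⊗ B ≈M A′ ⊗ B′
    ⊗-cong A≈A′ B≈B′ i j = sumF-cong (λ k → *-cong (A≈A′ i k) (B≈B′ k j))

    ⊕-cong : {A A′ B B′ : Mat l} → A ≈M A′ → B ≈M B′ → A ⊕ B ≈M A′ ⊕ B′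
    ⊕-cong A≈A′ B≈B′ i j = +-cong (A≈A′ i j) (B≈B′ i j)

    †-cong : {A B : Mat l} → A ≈M B → A † ≈M B †
    †-cong A≈B i j = conj-cong (A≈B j i)

    ⊗-assoc : (A B C : Mat l) → (A ⊗ B) ⊗ C ≈M A ⊗ (B ⊗ C)
    ⊗-assoc A B C i j = begin
      sumF (λ k → sumF (λ p → A i p * B p k) * C k j)
        ≈⟨ sumF-cong (λ k → *-distribʳ-sumF (C k j) (λ p → A i p * B p k)) ⟩
      sumF (λ k → sumF (λ p → A i p * B p k * C k j))
        ≈⟨ sumF-comm (λ k p → A i p * B p k * C k j) ⟩
      sumF (λ p → sumF (λ k → A i p * B p k * C k j))
        ≈⟨ sumF-cong (λ p → sumF-cong (λ k → *-assoc (A i p) (B p k) (C k j))) ⟩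
      sumF (λ p → sumF (λ k → A i p * (B p k * C k j)))
        ≈⟨ sumF-cong (λ p → *-distribˡ-sumF (A i p) (λ k → B p k * C k j)) ⟨
      sumF (λ p → A i p * sumF (λ k → B p k * C k j))
        ∎

    IM-diag : (i : Fin l) → IM i i ≈ 1#
    IM-diag i with i ≟ᶠ i
    ... | yes _   = refl
    ... | no i≢i = ⊥-elim (i≢i ≡.refl)

    IM-off : (i j : Fin l) → i ≢ j → IM i j ≈ 0#
    IM-off i j i≢j with i ≟ᶠ j
    ... | yes i≡j = ⊥-elim (i≢j i≡j)
    ... | no _    = refl

    ⊗-identityˡ : (A : Mat l) → IM ⊗ A ≈M A
    ⊗-identityˡ A i j = begin
      sumF (λ k → IM i k * A k j) ≈⟨ sumF-single _ i (λ k k≢i →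
                                       trans (*-congʳ (IM-off i k (λ i≡k → k≢i (≡.sym i≡k)))) (zeroˡ _)) ⟩
      IM i i * A i j              ≈⟨ *-congʳ (IM-diag i) ⟩
      1# * A i j                  ≈⟨ *-identityˡ _ ⟩
      A i j                       ∎

    ⊗-identityʳ : (A : Mat l) → A ⊗ IM ≈M A
    ⊗-identityʳ A i j = begin
      sumF (λ k → A i k * IM k j) ≈⟨ sumF-single _ j (λ k k≢j →
                                       trans (*-congˡ (IM-off k j k≢j)) (zeroʳ _)) ⟩
      A i j * IM j j              ≈⟨ *-congˡ (IM-diag j) ⟩
      A i j * 1#                  ≈⟨ *-identityʳ _ ⟩
      A i j                       ∎

    ⊗-zeroˡ : (A : Mat l) → 0M ⊗ A ≈M 0M
    ⊗-zeroˡ A i j = sumF-zero _ (λ k → zeroˡ (A k j))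

    ⊗-zeroʳ : (A : Mat l) → A ⊗ 0M ≈M 0M
    ⊗-zeroʳ A i j = sumF-zero _ (λ k → zeroʳ (A i k))

    ⊕-identityˡ : (A : Mat l) → 0M ⊕ A ≈M A
    ⊕-identityˡ A i j = +-identityˡ (A i j)

    ⊕-identityʳ : (A : Mat l) → A ⊕ 0M ≈M A
    ⊕-identityʳ A i j = +-identityʳ (A i j)

    0M-† : 0M † ≈M 0M {l}
    0M-† i j = conj-0

    sumM-single : ∀ {n} (f : Fin n → Mat l) (k : Fin n) →
                  (∀ j → j ≢ k → f j ≈M 0M) → sumM f ≈M f k
    sumM-single f k f≈0 i j = trans (sumM-entry f) (sumF-single _ k (λ p p≢k → f≈0 p p≢k i j))
      where
      sumM-entry : ∀ {n} (g : Fin n → Mat l) → sumM g i j ≈ sumF (λ p → g p i j)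
      sumM-entry {zero}  g = refl
      sumM-entry {suc n} g = +-congˡ (sumM-entry (λ p → g (suc p)))

  module _ {l : ℕ} where
    open SetoidReasoning (matSetoid l)

    ⊗-cancelˡ-unitary : {A X Y : Mat l} → A † ⊗ A ≈M IM → A ⊗ X ≈M A ⊗ Y → X ≈M Y
    ⊗-cancelˡ-unitary {A} {X} {Y} A†A≈I AX≈AY = begin
      X               ≈⟨ ⊗-identityˡ X ⟨
      IM ⊗ X          ≈⟨ ⊗-cong A†A≈I ≈M-refl ⟨
      (A † ⊗ A) ⊗ X   ≈⟨ ⊗-assoc _ _ _ ⟩
      A † ⊗ (A ⊗ X)   ≈⟨ ⊗-cong ≈M-refl AX≈AY ⟩
      A † ⊗ (A ⊗ Y)   ≈⟨ ⊗-assoc _ _ _ ⟨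
      (A † ⊗ A) ⊗ Y   ≈⟨ ⊗-cong A†A≈I ≈M-refl ⟩
      IM ⊗ Y          ≈⟨ ⊗-identityˡ Y ⟩
      Y               ∎

module UnitaryRepProperties {c ℓ} (R : InvRing c ℓ) (H : Hypergraph)
                            {k : ℕ} (V : Voltage H k) {l : ℕ} (U : UnitaryRep H R V l) where
  open Mat R
  open MatrixAlgebra R
  open UnitaryRep U
  open SetoidReasoning (matSetoid l)

  ρ-identity : ρ idₚ one ≈M IM
  ρ-identity = ⊗-cancelˡ-unitary (unitaryˡ one) (begin
    ρ idₚ one ⊗ ρ idₚ one          ≈⟨ ρ-hom one one ⟨
    ρ (idₚ ∘ₚ idₚ) (mul one one)   ≈⟨ ρ-cong (mul one one) one (λ _ → ≡.refl) ⟩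
    ρ idₚ one                      ≈⟨ ⊗-identityʳ _ ⟨
    ρ idₚ one ⊗ IM                 ∎)

  ρ-inverse : ∀ {σ} (p : InΓ H V σ) → ρ (flip σ) (inv' p) ≈M (ρ σ p) †
  ρ-inverse {σ} p = ⊗-cancelˡ-unitary (unitaryˡ p) (begin
    ρ σ p ⊗ ρ (flip σ) (inv' p)        ≈⟨ ρ-hom p (inv' p) ⟨
    ρ (σ ∘ₚ flip σ) (mul p (inv' p))   ≈⟨ ρ-cong (mul p (inv' p)) one (λ _ → inverseˡ σ) ⟩
    ρ idₚ one                          ≈⟨ ρ-identity ⟩
    IM                                 ≈⟨ unitaryʳ p ⟨
    ρ σ p ⊗ (ρ σ p) †                  ∎)

module _ (H : Hypergraph) where

  inv-involutive : ∀ a → inv H (inv H a) ≡ a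
  inv-involutive ((_ , _ , true)  , _) = ≡.refl
  inv-involutive ((_ , _ , false) , _) = ≡.refl

  o-inv : ∀ a → o H (inv H a) ≡ t H a
  o-inv ((_ , _ , true)  , _) = ≡.refl
  o-inv ((_ , _ , false) , _) = ≡.refl

module BlockEntries {c ℓ} (R : InvRing c ℓ) (H : Hypergraph)
                    {n m : ℕ} (xs : Fin n ↔ BVertex H) (es : Fin (2 *ℕ m) ↔ Arc H)
                    {k : ℕ} (V : Voltage H k) {l : ℕ} (U : UnitaryRep H R V l) where
  open Mat R
  open MatrixAlgebra R
  open UnitaryRepProperties R H V U
  open Matrices H R {n} {m} xs es V U
  open UnitaryRep U
  open Voltage V
  open Inverse using (from; strictlyInverseˡ; strictlyInverseʳ)
  open SetoidReasoning (matSetoid l)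

  ε-invIx : ∀ β → ε (invIx β) ≡ inv H (ε β)
  ε-invIx β = strictlyInverseˡ es (inv H (ε β))

  invIx-involutive : ∀ β → invIx (invIx β) ≡ β
  invIx-involutive β =
    ≡.trans (≡.cong (λ a → from es (inv H a)) (ε-invIx β))
            (≡.trans (≡.cong (from es) (inv-involutive H (ε β))) (strictlyInverseʳ es β))

  o-ε-invIx : ∀ β → o H (ε (invIx β)) ≡ t H (ε β)
  o-ε-invIx β = ≡.trans (≡.cong (o H) (ε-invIx β)) (o-inv H (ε β))

  ρφ-invIx : ∀ β → ρφ (invIx β) ≈M ρφ β †
  ρφ-invIx β = ≈M-trans
    (ρ-cong (gen (ε (invIx β))) (inv' (gen (ε β)))
            (λ i → ≡.trans (≡.cong (λ a → φ a ⟨$⟩ʳ i) (ε-invIx β)) (φ-inv (ε β) i)))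
    (ρ-inverse (gen (ε β)))

  target : Fin (2 *ℕ m) → Fin n
  target α = from xs (t H (ε α))

  x-target : ∀ α → x (target α) ≡ t H (ε α)
  x-target α = strictlyInverseˡ xs (t H (ε α))

  K-incident : ∀ α γ → t H (ε α) ≡ x γ → K α γ ≈M ρφ α
  K-incident α γ tα≡xγ with t H (ε α) ≟ᵛ x γ
  ... | yes _    = ≈M-refl
  ... | no tα≢xγ = ⊥-elim (tα≢xγ tα≡xγ)

  K-nonincident : ∀ α γ → t H (ε α) ≢ x γ → K α γ ≈M 0M
  K-nonincident α γ tα≢xγ with t H (ε α) ≟ᵛ x γ
  ... | yes tα≡xγ = ⊥-elim (tα≢xγ tα≡xγ)
  ... | no _      = ≈M-refl

  B-successor : ∀ α β → t H (ε α) ≡ o H (ε β) → α ≢ invIx β → B α β ≈M ρφ α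
  B-successor α β tα≡oβ α≢β⁻¹ with t H (ε α) ≟ᵛ o H (ε β) | α ≟ᶠ invIx β
  ... | yes _    | no _      = ≈M-refl
  ... | yes _    | yes α≡β⁻¹ = ⊥-elim (α≢β⁻¹ α≡β⁻¹)
  ... | no tα≢oβ | _         = ⊥-elim (tα≢oβ tα≡oβ)

  B-nonsuccessor : ∀ α β → t H (ε α) ≢ o H (ε β) → B α β ≈M 0M
  B-nonsuccessor α β tα≢oβ with t H (ε α) ≟ᵛ o H (ε β) | α ≟ᶠ invIx β
  ... | yes tα≡oβ | _     = ⊥-elim (tα≢oβ tα≡oβ)
  ... | no _      | yes _ = ≈M-refl
  ... | no _      | no _  = ≈M-refl

  B-reverse : ∀ α β → α ≡ invIx β → B α β ≈M 0M
  B-reverse α β α≡β⁻¹ with t H (ε α) ≟ᵛ o H (ε β) | α ≟ᶠ invIx β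
  ... | _     | no α≢β⁻¹ = ⊥-elim (α≢β⁻¹ α≡β⁻¹)
  ... | yes _ | yes _    = ≈M-refl
  ... | no _  | yes _    = ≈M-refl

  J-reverse : ∀ β → J (invIx β) β ≈M ρφ (invIx β)
  J-reverse β with invIx β ≟ᶠ invIx β
  ... | yes _ = ≈M-refl
  ... | no β⁻¹≢β⁻¹ = ⊥-elim (β⁻¹≢β⁻¹ ≡.refl)

  J-nonreverse : ∀ γ β → γ ≢ invIx β → J γ β ≈M 0M
  J-nonreverse γ β γ≢β⁻¹ with γ ≟ᶠ invIx β
  ... | yes γ≡β⁻¹ = ⊥-elim (γ≢β⁻¹ γ≡β⁻¹)
  ... | no _      = ≈M-refl

  IB-diag : ∀ α → IB {l} {2 *ℕ m} α α ≈M IM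
  IB-diag α with α ≟ᶠ α
  ... | yes _ = ≈M-refl
  ... | no α≢α = ⊥-elim (α≢α ≡.refl)

  IB-off : ∀ α β → α ≢ β → IB {l} {2 *ℕ m} α β ≈M 0M
  IB-off α β α≢β with α ≟ᶠ β
  ... | yes α≡β = ⊥-elim (α≢β α≡β)
  ... | no _    = ≈M-refl

  K-target : ∀ α → K α (target α) ≈M ρφ α
  K-target α = K-incident α (target α) (≡.sym (x-target α))

  K-nontarget : ∀ α γ → γ ≢ target α → K α γ ≈M 0M
  K-nontarget α γ γ≢target = K-nonincident α γ (λ tα≡xγ →
    γ≢target (≡.trans (≡.sym (strictlyInverseʳ xs γ)) (≡.cong (from xs) (≡.sym tα≡xγ))))

  K⊗K†-entry : ∀ α β → (K ⊗B (K †B)) α β ≈M ρφ α ⊗ K β (target α) †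
  K⊗K†-entry α β = begin
    sumM (λ γ → K α γ ⊗ K β γ †)
      ≈⟨ sumM-single _ (target α) (λ γ γ≢target →
           ≈M-trans (⊗-cong (K-nontarget α γ γ≢target) ≈M-refl) (⊗-zeroˡ _)) ⟩
    K α (target α) ⊗ K β (target α) †
      ≈⟨ ⊗-cong (K-target α) ≈M-refl ⟩
    ρφ α ⊗ K β (target α) † ∎

  B⊗J⊕I-entry : ∀ α β → ((B ⊗B J) ⊕B IB) α β ≈M B α (invIx β) ⊗ ρφ β † ⊕ IB α β
  B⊗J⊕I-entry α β = ⊕-cong (begin
    sumM (λ γ → B α γ ⊗ J γ β)
      ≈⟨ sumM-single _ (invIx β) (λ γ γ≢β⁻¹ →
           ≈M-trans (⊗-cong ≈M-refl (J-nonreverse γ β γ≢β⁻¹)) (⊗-zeroʳ _)) ⟩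
    B α (invIx β) ⊗ J (invIx β) β
      ≈⟨ ⊗-cong ≈M-refl (≈M-trans (J-reverse β) (ρφ-invIx β)) ⟩
    B α (invIx β) ⊗ ρφ β † ∎) ≈M-refl

  K⊗K†≈B⊗J⊕I-diagonal : ∀ α → (K ⊗B (K †B)) α α ≈M ((B ⊗B J) ⊕B IB) α α
  K⊗K†≈B⊗J⊕I-diagonal α = begin
    (K ⊗B (K †B)) α α                     ≈⟨ K⊗K†-entry α α ⟩
    ρφ α ⊗ K α (target α) †               ≈⟨ ⊗-cong ≈M-refl (†-cong (K-target α)) ⟩
    ρφ α ⊗ ρφ α †                         ≈⟨ unitaryʳ (gen (ε α)) ⟩
    IM                                    ≈⟨ ⊕-identityˡ IM ⟨
    0M ⊕ IM                               ≈⟨ ⊕-cong Bαα⁻¹⊗ρφα†≈0 (IB-diag α) ⟨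
    B α (invIx α) ⊗ ρφ α † ⊕ IB α α       ≈⟨ B⊗J⊕I-entry α α ⟨
    ((B ⊗B J) ⊕B IB) α α                  ∎
    where
    Bαα⁻¹⊗ρφα†≈0 : B α (invIx α) ⊗ ρφ α † ≈M 0M
    Bαα⁻¹⊗ρφα†≈0 = ≈M-trans (⊗-cong (B-reverse α (invIx α) (≡.sym (invIx-involutive α))) ≈M-refl)
                            (⊗-zeroˡ _)

  K⊗K†≈B⊗J⊕I-sameTarget : ∀ α β → t H (ε α) ≡ t H (ε β) → α ≢ β →
                           (K ⊗B (K †B)) α β ≈M ((B ⊗B J) ⊕B IB) α β
  K⊗K†≈B⊗J⊕I-sameTarget α β tα≡tβ α≢β = begin
    (K ⊗B (K †B)) α β                     ≈⟨ K⊗K†-entry α β ⟩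
    ρφ α ⊗ K β (target α) †               ≈⟨ ⊗-cong ≈M-refl (†-cong (K-incident β (target α) tβ≡x-target)) ⟩
    ρφ α ⊗ ρφ β †                         ≈⟨ ⊕-identityʳ _ ⟨
    ρφ α ⊗ ρφ β † ⊕ 0M                    ≈⟨ ⊕-cong (⊗-cong Bαβ⁻¹≈ρφα ≈M-refl) (IB-off α β α≢β) ⟨
    B α (invIx β) ⊗ ρφ β † ⊕ IB α β       ≈⟨ B⊗J⊕I-entry α β ⟨
    ((B ⊗B J) ⊕B IB) α β                  ∎
    where
    tβ≡x-target : t H (ε β) ≡ x (target α)
    tβ≡x-target = ≡.trans (≡.sym tα≡tβ) (≡.sym (x-target α))
    Bαβ⁻¹≈ρφα : B α (invIx β) ≈M ρφ α
    Bαβ⁻¹≈ρφα = B-successor α (invIx β) (≡.trans tα≡tβ (≡.sym (o-ε-invIx β)))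
                            (λ α≡β⁻¹⁻¹ → α≢β (≡.trans α≡β⁻¹⁻¹ (invIx-involutive β)))

  K⊗K†≈B⊗J⊕I-differentTarget : ∀ α β → t H (ε α) ≢ t H (ε β) →
                                (K ⊗B (K †B)) α β ≈M ((B ⊗B J) ⊕B IB) α β
  K⊗K†≈B⊗J⊕I-differentTarget α β tα≢tβ = begin
    (K ⊗B (K †B)) α β                     ≈⟨ K⊗K†-entry α β ⟩
    ρφ α ⊗ K β (target α) †               ≈⟨ ⊗-cong ≈M-refl (≈M-trans (†-cong Kβ-target≈0) 0M-†) ⟩
    ρφ α ⊗ 0M                             ≈⟨ ⊗-zeroʳ _ ⟩
    0M                                    ≈⟨ ⊕-identityˡ 0M ⟨
    0M ⊕ 0M                               ≈⟨ ⊕-cong Bαβ⁻¹⊗ρφβ†≈0 (IB-off α β α≢β) ⟨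
    B α (invIx β) ⊗ ρφ β † ⊕ IB α β       ≈⟨ B⊗J⊕I-entry α β ⟨
    ((B ⊗B J) ⊕B IB) α β                  ∎
    where
    α≢β : α ≢ β
    α≢β α≡β = tα≢tβ (≡.cong (λ γ → t H (ε γ)) α≡β)
    Kβ-target≈0 : K β (target α) ≈M 0M
    Kβ-target≈0 = K-nonincident β (target α) (λ tβ≡ → tα≢tβ (≡.sym (≡.trans tβ≡ (x-target α))))
    Bαβ⁻¹⊗ρφβ†≈0 : B α (invIx β) ⊗ ρφ β † ≈M 0M
    Bαβ⁻¹⊗ρφβ†≈0 = ≈M-trans (⊗-cong (B-nonsuccessor α (invIx β) (λ tα≡ → tα≢tβ (≡.trans tα≡ (o-ε-invIx β))))
                                    ≈M-refl)
                            (⊗-zeroˡ _)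

  -- The decision is an argument rather than a `with α ≟ᶠ β`, which would also abstract the
  -- same test inside IB α β.
  K⊗K†≈B⊗J⊕I-entry : ∀ α β → Dec (α ≡ β) → (K ⊗B (K †B)) α β ≈M ((B ⊗B J) ⊕B IB) α β
  K⊗K†≈B⊗J⊕I-entry α .α (yes ≡.refl) = K⊗K†≈B⊗J⊕I-diagonal α
  K⊗K†≈B⊗J⊕I-entry α β  (no α≢β) with t H (ε α) ≟ᵛ t H (ε β)
  ... | yes tα≡tβ = K⊗K†≈B⊗J⊕I-sameTarget α β tα≡tβ α≢β
  ... | no tα≢tβ  = K⊗K†≈B⊗J⊕I-differentTarget α β tα≢tβ

  K⊗K†≈B⊗J⊕I : (K ⊗B (K †B)) ≈B ((B ⊗B J) ⊕B IB)
  K⊗K†≈B⊗J⊕I α β = K⊗K†≈B⊗J⊕I-entry α β (α ≟ᶠ β)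

lemma4p14 : ∀ {c ℓ} (R : InvRing c ℓ) (H : Hypergraph) →
    Connected H → NoLoops H → EveryVertexInTwoEdges H →
    (n m : ℕ) (xs : Fin n ↔ BVertex H) (es : Fin (2 *ℕ m) ↔ Arc H) →
    (k : ℕ) (V : Voltage H k) (l : ℕ) (U : UnitaryRep H R V l) →
    let open Mat R in
    let open Matrices H R {n} {m} xs es V U in
    (K ⊗B (K †B)) ≈B ((B ⊗B J) ⊕B IB)
lemma4p14 R H _ _ _ n m xs es k V l U = BlockEntries.K⊗K†≈B⊗J⊕I R H {n} {m} xs es V U
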